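{- Let $p\ge 7$ be a prime. Let $M$ be the $p\times p$ tridiagonal matrix with diagonal entries $M_{11}=M_{pp}=p-1$ and $M_{ii}=p-2$ for $2\le i\le p-1$, with $M_{i,i+1}=M_{i+1,i}=1$ for $1\le i\le p-1$, and with all other entries $0$. Let $\mathbf{x}=(x_1,\dots,x_p)^T$ be a vector of non-negative integers satisfying $M\mathbf{x}\le (p-1)!\,\mathbf{1}$ entrywise, where $\mathbf{1}$ is the all-ones vector. Let $x_{\max}=\max\{x_i: 1\le i\le p\}$. Then: (1) $\left|\{i\in[p]: x_i\le \frac{(p-1)!}{p}\}\right|\ge \lceil p/3\rceil$; (2) if $\sum_{i=1}^p x_i=(p-1)!-k$ for an integer $k$, then $|\{i\in[p]: x_i=x_{\max}\}|\ge p-k-2$; (3) $\sum_{i=1}^p x_i\le (p-1)!-\lceil p/3\rceil+2$. -}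

module Defs where

open import Data.Nat using (ℕ; zero; suc; _+_; _*_; _∸_; _≤_; _≤?_; _⊔_; _/_)
open import Data.Nat.Properties using (_≟_)
open import Data.Fin using (Fin; toℕ)
open import Data.List using (List; map; filter; length; foldr; allFin)
open import Data.Nat.ListAction using (sum)
open import Relation.Unary using (Pred; Decidable)
open import Level using (0ℓ)
open import Data.Bool using (if_then_else_)
open import Relation.Nullary.Decidable using (⌊_⌋)

Mentry : (p : ℕ) → Fin p → Fin p → ℕ
Mentry p i j =
  let a = toℕ i ; b = toℕ j in
  if ⌊ a ≟ b ⌋
    then (if ⌊ a ≟ 0 ⌋ then p ∸ 1 else if ⌊ a ≟ p ∸ 1 ⌋ then p ∸ 1 else p ∸ 2)
    else (if ⌊ suc a ≟ b ⌋ then 1 else if ⌊ suc b ≟ a ⌋ then 1 else 0)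

Σ[Fin] : (p : ℕ) → (Fin p → ℕ) → ℕ
Σ[Fin] p f = sum (map f (allFin p))

Mx : (p : ℕ) → (Fin p → ℕ) → Fin p → ℕ
Mx p x i = Σ[Fin] p (λ j → Mentry p i j * x j)

xmax : (p : ℕ) → (Fin p → ℕ) → ℕ
xmax p x = foldr _⊔_ 0 (map x (allFin p))

count : (p : ℕ) → {P : Pred (Fin p) 0ℓ} → Decidable P → ℕ
count p P? = length (filter P? (allFin p))

-- Row i of M x ≤ N reads x_{i-1} + (p-2) x_i + x_{i+1} ≤ N (with weight p-1 on the end rows), and the
-- weights in every row sum to p. Hence the entries of a row window (the first two, three consecutive, or
-- the last two indices) cannot all exceed N/p; covering [p] by such windows gives at least ⌈p/3⌉ small
-- entries. If the maximum m is attained at c, row c bounds its neighbours by N - (p-2) m, and every other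
-- entry that is not maximal is at most m - 1; summing gives p + Σ x ≤ N + 2 + #{i : x_i = m}.
-- For the total, either p m ≤ N, and then p m ≤ N - (p-1) because (p-1)! ≡ -1 (mod p) by Wilson's
-- theorem; or no maximal entry is small, so the maximal and the small indices are disjoint, and adding
-- the two counts gives p + Σ x + ⌈p/3⌉ ≤ N + 2 + p.

module Submission where

open import Data.Bool using (if_then_else_)
open import Data.Empty using (⊥; ⊥-elim)
open import Data.Fin using (Fin; toℕ; fromℕ<) renaming (zero to fzero; suc to fsuc)
open import Data.Fin.Properties using (any?; toℕ<n; toℕ-fromℕ<; fromℕ<-toℕ)
open import Data.List using ([]; _∷_; map; filter; length; foldr; tabulate; allFin)
open import Data.List.Properties using (map-tabulate)
open import Data.Nat
open import Data.Nat.Coprimality using (coprime-Bézout; prime⇒coprime) renaming (sym to coprime-sym)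
open import Data.Nat.DivMod
open import Data.Nat.Divisibility using (_∣_; divides; >⇒∤)
open import Data.Nat.GCD using (module Bézout)
open import Data.Nat.ListAction using (sum)
open import Data.Nat.Primality using (Prime; euclidsLemma; ¬prime[1])
open import Data.Nat.Properties
open import Data.Nat.Tactic.RingSolver using (solve-∀)
open import Data.Product using (_×_; _,_; proj₁; proj₂; ∃-syntax; map₂; uncurry)
open import Data.Sum using (_⊎_; inj₁; inj₂)
open import Function using (id)
open import Level using (0ℓ)
open import Relation.Binary.Definitions using (tri<; tri≈; tri>)
open import Relation.Binary.PropositionalEquality
open import Relation.Nullary using (Dec; yes; no; ¬_; contradiction)
open import Relation.Nullary.Decidable using (⌊_⌋)
open import Relation.Unary using (Pred; Decidable)

open import Algebra.Properties.CommutativeSemigroup +-commutativeSemigroup using (interchange)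

open import Defs

-- Sums and products over ranges of ℕ

sumFrom : ℕ → ℕ → (ℕ → ℕ) → ℕ
sumFrom s zero    f = 0
sumFrom s (suc n) f = f s + sumFrom (suc s) n f

prodFrom : ℕ → ℕ → (ℕ → ℕ) → ℕ
prodFrom s zero    f = 1
prodFrom s (suc n) f = f s * prodFrom (suc s) n f

sumFrom-+ : ∀ s m n f → sumFrom s (m + n) f ≡ sumFrom s m f + sumFrom (s + m) n f
sumFrom-+ s zero    n f = cong (λ t → sumFrom t n f) (sym (+-identityʳ s))
sumFrom-+ s (suc m) n f = begin
  f s + sumFrom (suc s) (m + n) f
    ≡⟨ cong (f s +_) (sumFrom-+ (suc s) m n f) ⟩
  f s + (sumFrom (suc s) m f + sumFrom (suc s + m) n f)
    ≡⟨ +-assoc (f s) _ _ ⟨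
  f s + sumFrom (suc s) m f + sumFrom (suc s + m) n f
    ≡⟨ cong (λ t → f s + sumFrom (suc s) m f + sumFrom t n f) (+-suc s m) ⟨
  f s + sumFrom (suc s) m f + sumFrom (s + suc m) n f ∎
  where open ≡-Reasoning

sumFrom-mono : ∀ s n {f h : ℕ → ℕ} → (∀ k → f k ≤ h k) → sumFrom s n f ≤ sumFrom s n h
sumFrom-mono s zero    f≤h = z≤n
sumFrom-mono s (suc n) f≤h = +-mono-≤ (f≤h s) (sumFrom-mono (suc s) n f≤h)

sumFrom≤* : ∀ s n {f} {c} → (∀ k → f k ≤ c) → sumFrom s n f ≤ n * c
sumFrom≤* s zero    f≤c = z≤n
sumFrom≤* s (suc n) f≤c = +-mono-≤ (f≤c s) (sumFrom≤* (suc s) n f≤c)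

sumFrom-distrib-+ : ∀ s n f h → sumFrom s n (λ k → f k + h k) ≡ sumFrom s n f + sumFrom s n h
sumFrom-distrib-+ s zero    f h = refl
sumFrom-distrib-+ s (suc n) f h = begin
  f s + h s + sumFrom (suc s) n (λ k → f k + h k)
    ≡⟨ cong (f s + h s +_) (sumFrom-distrib-+ (suc s) n f h) ⟩
  f s + h s + (sumFrom (suc s) n f + sumFrom (suc s) n h)
    ≡⟨ interchange (f s) (h s) _ _ ⟩
  f s + sumFrom (suc s) n f + (h s + sumFrom (suc s) n h) ∎
  where open ≡-Reasoning

window≤sumFrom : ∀ {a w n} f → a + w ≤ n → sumFrom a w f ≤ sumFrom 0 n f
window≤sumFrom {a} {w} {n} f a+w≤n with m≤n⇒∃[o]m+o≡n a+w≤n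
... | b , refl = begin
  sumFrom a w f                                  ≤⟨ m≤n+m _ _ ⟩
  sumFrom 0 a f + sumFrom a w f                  ≡⟨ sumFrom-+ 0 a w f ⟨
  sumFrom 0 (a + w) f                            ≤⟨ m≤m+n _ _ ⟩
  sumFrom 0 (a + w) f + sumFrom (a + w) b f      ≡⟨ sumFrom-+ 0 (a + w) b f ⟨
  sumFrom 0 (a + w + b) f                        ∎
  where open ≤-Reasoning

sumFrom≤window : ∀ a w b {n f c} → a + w + b ≡ n → (∀ k → f k ≤ c) →
                 sumFrom 0 n f ≤ sumFrom a w f + (a + b) * c
sumFrom≤window a w b {f = f} {c} refl f≤c = begin
  sumFrom 0 (a + w + b) f
    ≡⟨ sumFrom-+ 0 (a + w) b f ⟩
  sumFrom 0 (a + w) f + sumFrom (a + w) b f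
    ≡⟨ cong (_+ sumFrom (a + w) b f) (sumFrom-+ 0 a w f) ⟩
  sumFrom 0 a f + sumFrom a w f + sumFrom (a + w) b f
    ≤⟨ +-mono-≤ (+-monoˡ-≤ _ (sumFrom≤* 0 a f≤c)) (sumFrom≤* (a + w) b f≤c) ⟩
  a * c + sumFrom a w f + b * c
    ≡⟨ rearrange (a * c) (sumFrom a w f) (b * c) ⟩
  sumFrom a w f + (a * c + b * c)
    ≡⟨ cong (sumFrom a w f +_) (*-distribʳ-+ c a b) ⟨
  sumFrom a w f + (a + b) * c ∎
  where
  open ≤-Reasoning
  rearrange : ∀ x y z → x + y + z ≡ y + (x + z)
  rearrange = solve-∀

sumFrom-const : ∀ s n c → sumFrom s n (λ _ → c) ≡ n * c
sumFrom-const s zero    c = refl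
sumFrom-const s (suc n) c = cong (c +_) (sumFrom-const (suc s) n c)

prodFrom-snoc : ∀ s n f → prodFrom s (suc n) f ≡ prodFrom s n f * f (s + n)
prodFrom-snoc s zero    f = trans (*-identityʳ (f s)) (trans (cong f (sym (+-identityʳ s))) (sym (*-identityˡ _)))
prodFrom-snoc s (suc n) f = begin
  f s * prodFrom (suc s) (suc n) f             ≡⟨ cong (f s *_) (prodFrom-snoc (suc s) n f) ⟩
  f s * (prodFrom (suc s) n f * f (suc s + n)) ≡⟨ *-assoc (f s) _ _ ⟨
  f s * prodFrom (suc s) n f * f (suc s + n)   ≡⟨ cong (λ t → f s * prodFrom (suc s) n f * f t) (+-suc s n) ⟨
  f s * prodFrom (suc s) n f * f (s + suc n)   ∎
  where open ≡-Reasoning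

InRange : ℕ → ℕ → ℕ → Set
InRange s n k = s ≤ k × k < s + n

private
  head-inRange : ∀ s n → InRange s (suc n) s
  head-inRange s n = ≤-refl , m<m+n s (s≤s z≤n)

  tail-inRange : ∀ {s n k} → InRange (suc s) n k → InRange s (suc n) k
  tail-inRange {s} {n} {k} (s<k , k<) = <⇒≤ s<k , subst (k <_) (sym (+-suc s n)) k<

prodFrom-cong : ∀ s n {f h} → (∀ k → InRange s n k → f k ≡ h k) → prodFrom s n f ≡ prodFrom s n h
prodFrom-cong s zero    f≡h = refl
prodFrom-cong s (suc n) f≡h =
  cong₂ _*_ (f≡h s (head-inRange s n)) (prodFrom-cong (suc s) n (λ k r → f≡h k (tail-inRange r)))

prodFrom-exchange : ∀ s n {f h} a → InRange s n a → (∀ k → InRange s n k → k ≢ a → f k ≡ h k) →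
                    prodFrom s n h * f a ≡ prodFrom s n f * h a
prodFrom-exchange s zero    a (s≤a , a<s+0) f≡h = ⊥-elim (<⇒≱ (subst (a <_) (+-identityʳ s) a<s+0) s≤a)
prodFrom-exchange s (suc n) {f} {h} a (s≤a , a<) f≡h with s ≟ a
... | yes refl = begin
  h s * prodFrom (suc s) n h * f s ≡⟨ cong (λ t → h s * t * f s) tail-agrees ⟨
  h s * prodFrom (suc s) n f * f s ≡⟨ swap (h s) _ (f s) ⟩
  f s * prodFrom (suc s) n f * h s ∎
  where
  open ≡-Reasoning
  tail-agrees : prodFrom (suc s) n f ≡ prodFrom (suc s) n h
  tail-agrees = prodFrom-cong (suc s) n (λ k r → f≡h k (tail-inRange r) (>⇒≢ (proj₁ r)))
  swap : ∀ x y z → x * y * z ≡ z * y * x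
  swap = solve-∀
... | no s≢a = begin
  h s * prodFrom (suc s) n h * f a   ≡⟨ *-assoc (h s) _ _ ⟩
  h s * (prodFrom (suc s) n h * f a) ≡⟨ cong₂ _*_ (sym (f≡h s (head-inRange s n) s≢a)) tail-exchange ⟩
  f s * (prodFrom (suc s) n f * h a) ≡⟨ *-assoc (f s) _ _ ⟨
  f s * prodFrom (suc s) n f * h a   ∎
  where
  open ≡-Reasoning
  tail-exchange : prodFrom (suc s) n h * f a ≡ prodFrom (suc s) n f * h a
  tail-exchange = prodFrom-exchange (suc s) n a (≤∧≢⇒< s≤a s≢a , subst (a <_) (+-suc s n) a<)
                                    (λ k r → f≡h k (tail-inRange r))

prodFrom-factorial : ∀ s n → s ! * prodFrom (suc s) n id ≡ (s + n) !
prodFrom-factorial s zero    = trans (*-identityʳ (s !)) (cong _! (sym (+-identityʳ s)))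
prodFrom-factorial s (suc n) = begin
  s ! * (suc s * prodFrom (suc (suc s)) n id) ≡⟨ *-assoc (s !) _ _ ⟨
  s ! * suc s * prodFrom (suc (suc s)) n id   ≡⟨ cong (_* prodFrom (suc (suc s)) n id) (*-comm (s !) (suc s)) ⟩
  suc s ! * prodFrom (suc (suc s)) n id       ≡⟨ prodFrom-factorial (suc s) n ⟩
  (suc s + n) !                               ≡⟨ cong _! (+-suc s n) ⟨
  (s + suc n) !                               ∎
  where open ≡-Reasoning

indicator : ∀ {A : Set} → Dec A → ℕ
indicator (yes _) = 1
indicator (no  _) = 0

length-filter≡sum : ∀ {A : Set} {P : Pred A 0ℓ} (P? : Decidable P) xs →
                    length (filter P? xs) ≡ sum (map (λ a → indicator (P? a)) xs)
length-filter≡sum P? []       = refl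
length-filter≡sum P? (a ∷ xs) with P? a
... | yes _ = cong suc (length-filter≡sum P? xs)
... | no  _ = length-filter≡sum P? xs

-- The trailing `+ 0` makes these match `sumFrom k 2` and `sumFrom k 3` definitionally.
indicator-some₂ : ∀ {A B : Set} (a? : Dec A) (b? : Dec B) → (¬ A → ¬ B → ⊥) →
                  1 ≤ indicator a? + (indicator b? + 0)
indicator-some₂ (yes _) _       _     = s≤s z≤n
indicator-some₂ (no _)  (yes _) _     = s≤s z≤n
indicator-some₂ (no ¬a) (no ¬b) ¬a¬b = ⊥-elim (¬a¬b ¬a ¬b)

indicator-some₃ : ∀ {A B C : Set} (a? : Dec A) (b? : Dec B) (c? : Dec C) → (¬ A → ¬ B → ¬ C → ⊥) →
                  1 ≤ indicator a? + (indicator b? + (indicator c? + 0))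
indicator-some₃ (yes _) _       _       _        = s≤s z≤n
indicator-some₃ (no _)  (yes _) _       _        = s≤s z≤n
indicator-some₃ (no _)  (no _)  (yes _) _        = s≤s z≤n
indicator-some₃ (no ¬a) (no ¬b) (no ¬c) ¬a¬b¬c = ⊥-elim (¬a¬b¬c ¬a ¬b ¬c)

indicator-disjoint : ∀ {A B : Set} (a? : Dec A) (b? : Dec B) → (A → B → ⊥) →
                     indicator a? + indicator b? ≤ 1
indicator-disjoint (yes a) (yes b) a∧b = ⊥-elim (a∧b a b)
indicator-disjoint (yes _) (no _)  _   = s≤s z≤n
indicator-disjoint (no _)  (yes _) _   = s≤s z≤n
indicator-disjoint (no _)  (no _)  _   = z≤n

indicator≤1 : ∀ {A : Set} (a? : Dec A) → indicator a? ≤ 1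
indicator≤1 (yes _) = s≤s z≤n
indicator≤1 (no _)  = z≤n

+1∸indicator≤ : ∀ {x m} → x ≤ m → (x≟m : Dec (x ≡ m)) → x + 1 ∸ indicator x≟m ≤ m
+1∸indicator≤ {x} x≤m (yes _)   = ≤-trans (≤-reflexive (m+n∸n≡m x 1)) x≤m
+1∸indicator≤ {x} x≤m (no  x≢m) = ≤-trans (≤-reflexive (+-comm x 1)) (≤∧≢⇒< x≤m x≢m)

<-weightedSum : ∀ {N W} u v w a b c → W ≡ u + v + w →
                N < W * a → N < W * b → N < W * c → N < u * a + v * b + w * c
<-weightedSum {N} {suc W′} u v w a b c W≡ N<Wa N<Wb N<Wc = *-cancelˡ-≤ W (begin
  W * suc N
    ≡⟨ cong (_* suc N) W≡ ⟩
  (u + v + w) * suc N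
    ≡⟨ distrib u v w (suc N) ⟩
  u * suc N + v * suc N + w * suc N
    ≤⟨ +-mono-≤ (+-mono-≤ (*-monoʳ-≤ u N<Wa) (*-monoʳ-≤ v N<Wb)) (*-monoʳ-≤ w N<Wc) ⟩
  u * (W * a) + v * (W * b) + w * (W * c)
    ≡⟨ factor W u v w a b c ⟩
  W * (u * a + v * b + w * c) ∎)
  where
  open ≤-Reasoning
  W : ℕ
  W = suc W′
  distrib : ∀ u v w x → (u + v + w) * x ≡ u * x + v * x + w * x
  distrib = solve-∀
  factor : ∀ W u v w a b c → u * (W * a) + v * (W * b) + w * (W * c) ≡ W * (u * a + v * b + w * c)
  factor = solve-∀

[m+2]/3≤n : ∀ {m n} → m ≤ 3 * n → (m + 2) / 3 ≤ n
[m+2]/3≤n {m} {n} m≤3n = s≤s⁻¹ (m<n*o⇒m/o<n (begin-strict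
  m + 2           ≤⟨ +-monoˡ-≤ 2 m≤3n ⟩
  3 * n + 2       <⟨ +-monoʳ-< (3 * n) (n<1+n 2) ⟩
  3 * n + 3       ≡⟨ rearrange n ⟩
  suc n * 3       ∎))
  where
  open ≤-Reasoning
  rearrange : ∀ n → 3 * n + 3 ≡ suc n * 3
  rearrange = solve-∀

-- Wilson's theorem

*-%-congʳ : ∀ a {b c} d .{{_ : NonZero d}} → b % d ≡ c % d → a * b % d ≡ a * c % d
*-%-congʳ a {b} {c} d b≡c = begin
  a * b % d             ≡⟨ %-distribˡ-* a b d ⟩
  (a % d) * (b % d) % d ≡⟨ cong (λ x → (a % d) * x % d) b≡c ⟩
  (a % d) * (c % d) % d ≡⟨ %-distribˡ-* a c d ⟨
  a * c % d             ∎
  where open ≡-Reasoning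

%≡%⇒∣∸ : ∀ m n d .{{_ : NonZero d}} → m % d ≡ n % d → d ∣ m ∸ n
%≡%⇒∣∸ m n d m≡n = divides (m / d ∸ n / d) (begin
  m ∸ n                                       ≡⟨ cong₂ _∸_ (m≡m%n+[m/n]*n m d) (m≡m%n+[m/n]*n n d) ⟩
  (m % d + m / d * d) ∸ (n % d + n / d * d)   ≡⟨ cong (λ r → m % d + m / d * d ∸ (r + n / d * d)) m≡n ⟨
  (m % d + m / d * d) ∸ (m % d + n / d * d)   ≡⟨ [m+n]∸[m+o]≡n∸o (m % d) _ _ ⟩
  m / d * d ∸ n / d * d                       ≡⟨ *-distribʳ-∸ d (m / d) (n / d) ⟨
  (m / d ∸ n / d) * d                         ∎)
  where open ≡-Reasoning

∣∧<⇒≡0 : ∀ {d n} → d ∣ n → n < d → n ≡ 0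
∣∧<⇒≡0 {n = zero}  _   _   = refl
∣∧<⇒≡0 {n = suc n} d∣n n<d = contradiction d∣n (>⇒∤ n<d)

module OddPrime (q : ℕ) (prime : Prime (3 + q)) where

  p : ℕ
  p = 3 + q

  *-cancelˡ-≤-% : ∀ {a b c} → 0 < a → a < p → b < p → a * b % p ≡ a * c % p → b ≤ c
  *-cancelˡ-≤-% {suc a} {b} {c} _ a<p b<p ab≡ac with euclidsLemma (suc a) (b ∸ c) prime p∣a[b∸c]
    where
    p∣a[b∸c] : p ∣ suc a * (b ∸ c)
    p∣a[b∸c] = subst (p ∣_) (sym (*-distribˡ-∸ (suc a) b c))
                     (%≡%⇒∣∸ (suc a * b) (suc a * c) p ab≡ac)
  ... | inj₁ p∣a   = contradiction p∣a (>⇒∤ a<p)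
  ... | inj₂ p∣b∸c = m∸n≡0⇒m≤n (∣∧<⇒≡0 p∣b∸c (≤-<-trans (m∸n≤m b c) b<p))

  *-cancelˡ-% : ∀ {a b c} → 0 < a → a < p → b < p → c < p → a * b % p ≡ a * c % p → b ≡ c
  *-cancelˡ-% a>0 a<p b<p c<p ab≡ac =
    ≤-antisym (*-cancelˡ-≤-% a>0 a<p b<p ab≡ac) (*-cancelˡ-≤-% a>0 a<p c<p (sym ab≡ac))

  inverse-exists : ∀ {a} → 0 < a → a < p → ∃[ b ] a * b % p ≡ 1
  inverse-exists {a@(suc _)} _ a<p with coprime-Bézout (coprime-sym (prime⇒coprime prime a<p))
  ... | Bézout.+- x y eq = x , (begin
    a * x % p       ≡⟨ cong (_% p) (*-comm a x) ⟩
    x * a % p       ≡⟨ cong (_% p) eq ⟨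
    (1 + y * p) % p ≡⟨ [m+kn]%n≡m%n 1 y p ⟩
    1               ∎)
    where open ≡-Reasoning
  ... | Bézout.-+ x y eq = (2 + q) * x , (begin  -- 2 + q = p - 1 acts as -1
    a * ((2 + q) * x) % p           ≡⟨ [m+n]%n≡m%n (a * ((2 + q) * x)) p ⟨
    (a * ((2 + q) * x) + p) % p     ≡⟨ cong (_% p) (shift q a x) ⟩
    (1 + (2 + q) * (1 + x * a)) % p ≡⟨ cong (λ t → (1 + (2 + q) * t) % p) eq ⟩
    (1 + (2 + q) * (y * p)) % p     ≡⟨ cong (λ t → (1 + t) % p) (*-assoc (2 + q) y p) ⟨
    (1 + (2 + q) * y * p) % p       ≡⟨ [m+kn]%n≡m%n 1 ((2 + q) * y) p ⟩
    1                               ∎)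
    where
    open ≡-Reasoning
    shift : ∀ q a x → a * ((2 + q) * x) + (3 + q) ≡ 1 + (2 + q) * (1 + x * a)
    shift = solve-∀

  -- 0 when a has no inverse, i.e. when p ∣ a.
  inverse : ℕ → ℕ
  inverse a with any? (λ (b : Fin p) → a * toℕ b % p ≟ 1)
  ... | yes (b , _) = toℕ b
  ... | no  _       = 0

  inverse-< : ∀ a → inverse a < p
  inverse-< a with any? (λ (b : Fin p) → a * toℕ b % p ≟ 1)
  ... | yes (b , _) = toℕ<n b
  ... | no  _       = z<s

  inverseʳ : ∀ {a} → 0 < a → a < p → a * inverse a % p ≡ 1
  inverseʳ {a} a>0 a<p with any? (λ (b : Fin p) → a * toℕ b % p ≟ 1)
  ... | yes (_ , ab≡1) = ab≡1
  ... | no  ∄b         = contradiction (fromℕ< (m%n<n b p) , reduced) ∄b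
    where
    b : ℕ
    b = proj₁ (inverse-exists a>0 a<p)
    reduced : a * toℕ (fromℕ< (m%n<n b p)) % p ≡ 1
    reduced = begin
      a * toℕ (fromℕ< (m%n<n b p)) % p ≡⟨ cong (λ t → a * t % p) (toℕ-fromℕ< (m%n<n b p)) ⟩
      a * (b % p) % p                  ≡⟨ *-%-congʳ a p (m%n%n≡m%n b p) ⟩
      a * b % p                        ≡⟨ proj₂ (inverse-exists a>0 a<p) ⟩
      1                                ∎
      where open ≡-Reasoning

  inverse>0 : ∀ {a} → 0 < a → a < p → 0 < inverse a
  inverse>0 {a} a>0 a<p = n≢0⇒n>0 λ inv≡0 → contradiction (begin
    1                 ≡⟨ inverseʳ a>0 a<p ⟨
    a * inverse a % p ≡⟨ cong (λ t → a * t % p) inv≡0 ⟩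
    a * 0 % p         ≡⟨ cong (_% p) (*-zeroʳ a) ⟩
    0                 ∎) λ ()
    where open ≡-Reasoning

  inverse-unique : ∀ {a b} → 0 < a → a < p → b < p → a * b % p ≡ 1 → inverse a ≡ b
  inverse-unique {a} a>0 a<p b<p ab≡1 =
    *-cancelˡ-% a>0 a<p (inverse-< a) b<p (trans (inverseʳ a>0 a<p) (sym ab≡1))

  inverse-involutive : ∀ {a} → 0 < a → a < p → inverse (inverse a) ≡ a
  inverse-involutive {a} a>0 a<p = inverse-unique (inverse>0 a>0 a<p) (inverse-< a) a<p
    (trans (cong (_% p) (*-comm (inverse a) a)) (inverseʳ a>0 a<p))

  inverse≡selfInverse : ∀ {a c} → 0 < a → a < p → 0 < c → c < p → c * c % p ≡ 1 →
                        inverse a ≡ c → a ≡ c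
  inverse≡selfInverse {a} {c} a>0 a<p c>0 c<p cc≡1 inv≡c = begin
    a                   ≡⟨ inverse-involutive a>0 a<p ⟨
    inverse (inverse a) ≡⟨ cong inverse inv≡c ⟩
    inverse c           ≡⟨ inverse-unique c>0 c<p c<p cc≡1 ⟩
    c                   ∎
    where open ≡-Reasoning

  square≡1⇒±1 : ∀ {a} → 0 < a → a < p → a * a % p ≡ 1 → a ≡ 1 ⊎ a ≡ 2 + q
  square≡1⇒±1 {suc a} _ a<p aa≡1
    with euclidsLemma a (2 + a) prime (%≡%⇒∣∸ (1 + a * (2 + a)) 1 p aa≡1′)
    where
    aa≡1′ : (1 + a * (2 + a)) % p ≡ 1 % p
    aa≡1′ = trans (cong (_% p) (expand a)) aa≡1
      where
      expand : ∀ a → 1 + a * (2 + a) ≡ suc a * suc a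
      expand = solve-∀
  ... | inj₁ p∣a   = inj₁ (cong suc (∣∧<⇒≡0 p∣a (<-trans (n<1+n a) a<p)))
  ... | inj₂ p∣2+a with m≤n⇒m<n∨m≡n a<p
  ...   | inj₁ 2+a<p = contradiction (∣∧<⇒≡0 p∣2+a 2+a<p) λ ()
  ...   | inj₂ 2+a≡p = inj₂ (suc-injective 2+a≡p)

  [p-1]²≡1 : (2 + q) * (2 + q) % p ≡ 1
  [p-1]²≡1 = trans (cong (_% p) (expand q)) ([m+kn]%n≡m%n 1 (1 + q) p)
    where
    expand : ∀ q → (2 + q) * (2 + q) ≡ 1 + (1 + q) * (3 + q)
    expand = solve-∀

  private
    2≤⇒>0 : ∀ {a} → 2 ≤ a → 0 < a
    2≤⇒>0 = <-trans z<s

    ≤1+q⇒<p : ∀ {a} → a ≤ 1 + q → a < p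
    ≤1+q⇒<p a≤1+q = s≤s (m≤n⇒m≤1+n a≤1+q)

  inverse≢self : ∀ {a} → 2 ≤ a → a ≤ 1 + q → inverse a ≢ a
  inverse≢self {a} 2≤a a≤1+q inv≡a with square≡1⇒±1 (2≤⇒>0 2≤a) (≤1+q⇒<p a≤1+q) aa≡1
    where
    aa≡1 : a * a % p ≡ 1
    aa≡1 = subst (λ t → a * t % p ≡ 1) inv≡a (inverseʳ (2≤⇒>0 2≤a) (≤1+q⇒<p a≤1+q))
  ... | inj₁ a≡1   = contradiction (subst (2 ≤_) a≡1 2≤a) λ { (s≤s ()) }
  ... | inj₂ a≡2+q = contradiction (subst (_≤ 1 + q) a≡2+q a≤1+q) 1+n≰n

  inverse-bounds : ∀ {a} → 2 ≤ a → a ≤ 1 + q → 2 ≤ inverse a × inverse a ≤ 1 + q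
  inverse-bounds {a} 2≤a a≤1+q =
    ≤∧≢⇒< (inverse>0 a>0 a<p)
          (λ 1≡inv → a≢1 (inverse≡selfInverse a>0 a<p z<s (s≤s z<s) refl (sym 1≡inv))) ,
    s≤s⁻¹ (≤∧≢⇒< (s≤s⁻¹ (inverse-< a))
                  (λ inv≡2+q → a≢2+q (inverse≡selfInverse a>0 a<p z<s ≤-refl [p-1]²≡1 inv≡2+q)))
    where
    a>0 : 0 < a
    a>0 = 2≤⇒>0 2≤a
    a<p : a < p
    a<p = ≤1+q⇒<p a≤1+q
    a≢1 : a ≢ 1
    a≢1 refl = contradiction 2≤a λ { (s≤s ()) }
    a≢2+q : a ≢ 2 + q
    a≢2+q refl = 1+n≰n a≤1+q

  pairedFactor : ℕ → ℕ → ℕ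
  pairedFactor n k with inverse k ≤? n
  ... | yes _ = k
  ... | no  _ = 1

  pairedFactor-≤ : ∀ n k → inverse k ≤ n → pairedFactor n k ≡ k
  pairedFactor-≤ n k inv≤n with inverse k ≤? n
  ... | yes _    = refl
  ... | no  inv≰n = contradiction inv≤n inv≰n

  pairedFactor-> : ∀ n k → n < inverse k → pairedFactor n k ≡ 1
  pairedFactor-> n k n<inv with inverse k ≤? n
  ... | yes inv≤n = contradiction inv≤n (<⇒≱ n<inv)
  ... | no  _     = refl

  pairedFactor-suc : ∀ n k → inverse k ≢ suc n → pairedFactor n k ≡ pairedFactor (suc n) k
  pairedFactor-suc n k inv≢1+n with inverse k ≤? n | inverse k ≤? suc n
  ... | yes _     | yes _       = refl
  ... | yes inv≤n | no  inv≰1+n = contradiction (m≤n⇒m≤1+n inv≤n) inv≰1+n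
  ... | no  inv≰n | yes inv≤1+n = contradiction (≤-antisym inv≤1+n (≰⇒> inv≰n)) inv≢1+n
  ... | no  _     | no  _       = refl

  -- The product of the k ∈ [2, t + 1] whose inverse is also at most t + 1. These k pair off with
  -- their inverses (no k ∈ [2, p - 2] is its own inverse), so the product is 1 mod p; at t = q it is (p - 2)!.
  pairedProduct : ℕ → ℕ
  pairedProduct t = prodFrom 2 t (pairedFactor (1 + t))

  private
    inRange⇒bounds : ∀ {t k} → t ≤ q → InRange 2 t k → 2 ≤ k × k ≤ 1 + q
    inRange⇒bounds t≤q (2≤k , k<2+t) = 2≤k , ≤-trans (s≤s⁻¹ k<2+t) (s≤s t≤q)

  pairedProduct-step : ∀ t → 1 + t ≤ q → pairedProduct (suc t) % p ≡ pairedProduct t % p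
  pairedProduct-step t 1+t≤q with <-cmp (inverse (2 + t)) (2 + t)
  ... | tri≈ _ inv≡m _ = contradiction inv≡m (inverse≢self (s≤s (s≤s z≤n)) (s≤s 1+t≤q))
  ... | tri< inv<m _ _ = begin
    pairedProduct (suc t) % p
      ≡⟨ cong (_% p) (prodFrom-snoc 2 t h) ⟩
    prodFrom 2 t h * h m % p
      ≡⟨ cong₂ (λ x y → x * y % p) exchanged (pairedFactor-≤ m m (<⇒≤ inv<m)) ⟩
    pairedProduct t * inverse m * m % p
      ≡⟨ cong (_% p) (*-assoc (pairedProduct t) (inverse m) m) ⟩
    pairedProduct t * (inverse m * m) % p
      ≡⟨ *-%-congʳ (pairedProduct t) {c = 1} p inv*m≡1 ⟩
    pairedProduct t * 1 % p
      ≡⟨ cong (_% p) (*-identityʳ (pairedProduct t)) ⟩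
    pairedProduct t % p ∎
    where
    open ≡-Reasoning
    m : ℕ
    m = 2 + t
    f h : ℕ → ℕ
    f = pairedFactor (1 + t)
    h = pairedFactor m
    m<p : m < p
    m<p = s≤s (s≤s (m≤n⇒m≤1+n 1+t≤q))
    inv-bounds : 2 ≤ inverse m × inverse m ≤ 1 + q
    inv-bounds = inverse-bounds (s≤s (s≤s z≤n)) (s≤s 1+t≤q)
    inv-inv : inverse (inverse m) ≡ m
    inv-inv = inverse-involutive z<s m<p
    inv*m≡1 : inverse m * m % p ≡ 1
    inv*m≡1 = trans (cong (_% p) (*-comm (inverse m) m)) (inverseʳ z<s m<p)
    agree : ∀ k → InRange 2 t k → k ≢ inverse m → f k ≡ h k
    agree k r k≢inv = pairedFactor-suc (1 + t) k λ inv≡m → k≢inv (begin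
      k                   ≡⟨ inverse-involutive (2≤⇒>0 (proj₁ b)) (≤1+q⇒<p (proj₂ b)) ⟨
      inverse (inverse k) ≡⟨ cong inverse inv≡m ⟩
      inverse m           ∎)
      where
      b : 2 ≤ k × k ≤ 1 + q
      b = inRange⇒bounds (≤-trans (n≤1+n t) 1+t≤q) r
    exchanged : prodFrom 2 t h ≡ pairedProduct t * inverse m
    exchanged = begin
      prodFrom 2 t h
        ≡⟨ *-identityʳ (prodFrom 2 t h) ⟨
      prodFrom 2 t h * 1
        ≡⟨ cong (prodFrom 2 t h *_) (pairedFactor-> (1 + t) (inverse m) (≤-reflexive (sym inv-inv))) ⟨
      prodFrom 2 t h * f (inverse m)
        ≡⟨ prodFrom-exchange 2 t (inverse m) (proj₁ inv-bounds , inv<m) agree ⟩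
      prodFrom 2 t f * h (inverse m)
        ≡⟨ cong (prodFrom 2 t f *_) (pairedFactor-≤ m (inverse m) (≤-reflexive inv-inv)) ⟩
      prodFrom 2 t f * inverse m ∎
  ... | tri> _ _ m<inv = begin
    pairedProduct (suc t) % p  ≡⟨ cong (_% p) (prodFrom-snoc 2 t h) ⟩
    prodFrom 2 t h * h m % p   ≡⟨ cong (λ x → prodFrom 2 t h * x % p) (pairedFactor-> m m m<inv) ⟩
    prodFrom 2 t h * 1 % p     ≡⟨ cong (_% p) (*-identityʳ (prodFrom 2 t h)) ⟩
    prodFrom 2 t h % p         ≡⟨ cong (_% p) (prodFrom-cong 2 t agree) ⟨
    pairedProduct t % p        ∎
    where
    open ≡-Reasoning
    m : ℕ
    m = 2 + t
    f h : ℕ → ℕ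
    f = pairedFactor (1 + t)
    h = pairedFactor m
    agree : ∀ k → InRange 2 t k → f k ≡ h k
    agree k r@(_ , k<m) = pairedFactor-suc (1 + t) k λ inv≡m →
      <-asym k<m (<-≤-trans m<inv (≤-reflexive (trans (cong inverse (sym inv≡m)) (inverse-involutive k>0 k<p))))
      where
      b : 2 ≤ k × k ≤ 1 + q
      b = inRange⇒bounds (≤-trans (n≤1+n t) 1+t≤q) r
      k>0 : 0 < k
      k>0 = 2≤⇒>0 (proj₁ b)
      k<p : k < p
      k<p = ≤1+q⇒<p (proj₂ b)

  pairedProduct≡1 : ∀ t → t ≤ q → pairedProduct t % p ≡ 1
  pairedProduct≡1 zero    _       = refl
  pairedProduct≡1 (suc t) 1+t≤q =
    trans (pairedProduct-step t 1+t≤q) (pairedProduct≡1 t (≤-trans (n≤1+n t) 1+t≤q))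

  wilson : (2 + q) ! % p ≡ 2 + q
  wilson = begin
    (2 + q) * (1 + q) ! % p ≡⟨ *-%-congʳ (2 + q) {(1 + q) !} {1} p [p-2]!≡1 ⟩
    (2 + q) * 1 % p         ≡⟨ cong (_% p) (*-identityʳ (2 + q)) ⟩
    (2 + q) % p             ≡⟨ m<n⇒m%n≡m ≤-refl ⟩
    2 + q                   ∎
    where
    open ≡-Reasoning
    allPaired : ∀ k → InRange 2 q k → k ≡ pairedFactor (1 + q) k
    allPaired k r = sym (pairedFactor-≤ (1 + q) k (proj₂ (uncurry inverse-bounds (inRange⇒bounds ≤-refl r))))
    [p-2]!≡1 : (1 + q) ! % p ≡ 1
    [p-2]!≡1 = begin
      (1 + q) ! % p                ≡⟨ cong (_% p) (prodFrom-factorial 1 q) ⟨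
      1 * prodFrom 2 q id % p      ≡⟨ cong (_% p) (*-identityˡ (prodFrom 2 q id)) ⟩
      prodFrom 2 q id % p          ≡⟨ cong (_% p) (prodFrom-cong 2 q allPaired) ⟩
      pairedProduct q % p          ≡⟨ pairedProduct≡1 q ≤-refl ⟩
      1                            ∎

wilson : ∀ {p} .{{_ : NonZero p}} → Prime p → (p ∸ 1) ! % p ≡ p ∸ 1
wilson {1} p-prime = contradiction p-prime ¬prime[1]
wilson {2} _     = refl
wilson {suc (suc (suc q))} p-prime = OddPrime.wilson q p-prime

-- Fin-indexed vectors as ℕ-indexed sequences

sum-tabulate : ∀ n s {f : Fin n → ℕ} {g : ℕ → ℕ} → (∀ i → g (s + toℕ i) ≡ f i) →
               sum (tabulate f) ≡ sumFrom s n g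
sum-tabulate zero    s g≡f = refl
sum-tabulate (suc n) s {g = g} g≡f =
  cong₂ _+_ (trans (sym (g≡f fzero)) (cong g (+-identityʳ s)))
            (sum-tabulate n (suc s) (λ i → trans (cong g (sym (+-suc s (toℕ i)))) (g≡f (fsuc i))))

Σ[Fin]≡sumFrom : ∀ n {f : Fin n → ℕ} {g : ℕ → ℕ} → (∀ i → g (toℕ i) ≡ f i) →
                 Σ[Fin] n f ≡ sumFrom 0 n g
Σ[Fin]≡sumFrom n {f} g≡f = trans (cong sum (map-tabulate id f)) (sum-tabulate n 0 g≡f)

extend : ∀ {n} → (Fin n → ℕ) → ℕ → ℕ
extend {n} x k with k <? n
... | yes k<n = x (fromℕ< k<n)
... | no  _   = 0

extend-toℕ : ∀ {n} (x : Fin n → ℕ) i → extend x (toℕ i) ≡ x i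
extend-toℕ {n} x i with toℕ i <? n
... | yes i<n = cong x (fromℕ<-toℕ i i<n)
... | no  i≮n = contradiction (toℕ<n i) i≮n

extend-≤ : ∀ {n} (x : Fin n → ℕ) {m} → (∀ i → x i ≤ m) → ∀ k → extend x k ≤ m
extend-≤ {n} x x≤m k with k <? n
... | yes k<n = x≤m (fromℕ< k<n)
... | no  _   = z≤n

count≡sumFrom : ∀ n {P : Pred ℕ 0ℓ} (P? : Decidable P) (x : Fin n → ℕ) →
                count n (λ i → P? (x i)) ≡ sumFrom 0 n (λ k → indicator (P? (extend x k)))
count≡sumFrom n P? x = trans (length-filter≡sum (λ i → P? (x i)) (allFin n))
  (Σ[Fin]≡sumFrom n λ i → cong (λ v → indicator (P? v)) (extend-toℕ x i))

private
  foldr-⊔≡xmax : ∀ n (x : Fin n → ℕ) → foldr _⊔_ 0 (tabulate x) ≡ xmax n x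
  foldr-⊔≡xmax n x = sym (cong (foldr _⊔_ 0) (map-tabulate id x))

  ≤-foldr-⊔ : ∀ n (x : Fin n → ℕ) i → x i ≤ foldr _⊔_ 0 (tabulate x)
  ≤-foldr-⊔ (suc n) x fzero    = m≤m⊔n _ _
  ≤-foldr-⊔ (suc n) x (fsuc i) = ≤-trans (≤-foldr-⊔ n (λ j → x (fsuc j)) i) (m≤n⊔m (x fzero) _)

  foldr-⊔-attained : ∀ n (x : Fin (suc n) → ℕ) → ∃[ i ] x i ≡ foldr _⊔_ 0 (tabulate x)
  foldr-⊔-attained zero    x = fzero , sym (⊔-identityʳ (x fzero))
  foldr-⊔-attained (suc n) x
    with foldr-⊔-attained n (λ j → x (fsuc j)) | ⊔-sel (x fzero) (foldr _⊔_ 0 (tabulate (λ j → x (fsuc j))))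
  ... | _ , _   | inj₁ max≡x₀   = fzero , sym max≡x₀
  ... | i , xᵢ≡ | inj₂ max≡rest = fsuc i , trans xᵢ≡ (sym max≡rest)

xmax-upper : ∀ n (x : Fin n → ℕ) i → x i ≤ xmax n x
xmax-upper n x i = subst (x i ≤_) (foldr-⊔≡xmax n x) (≤-foldr-⊔ n x i)

xmax-attained : ∀ n (x : Fin (suc n) → ℕ) → ∃[ i ] x i ≡ xmax (suc n) x
xmax-attained n x = map₂ (λ xᵢ≡ → trans xᵢ≡ (foldr-⊔≡xmax (suc n) x)) (foldr-⊔-attained n x)

-- Mentry p i j reduces to tridiag p (toℕ i) (toℕ j).
tridiag : ℕ → ℕ → ℕ → ℕ
tridiag p a b =
  if ⌊ a ≟ b ⌋
    then (if ⌊ a ≟ 0 ⌋ then p ∸ 1 else if ⌊ a ≟ p ∸ 1 ⌋ then p ∸ 1 else p ∸ 2)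
    else (if ⌊ suc a ≟ b ⌋ then 1 else if ⌊ suc b ≟ a ⌋ then 1 else 0)

tridiag-sub : ∀ p a → tridiag p (suc a) a ≡ 1
tridiag-sub p a with suc a ≟ a
... | yes 1+a≡a = contradiction 1+a≡a (1+n≢n)
... | no  _ with suc (suc a) ≟ a
...   | yes 2+a≡a = contradiction 2+a≡a (>⇒≢ (m<n⇒m<1+n (n<1+n a)))
...   | no  _ with suc a ≟ suc a
...     | yes _       = refl
...     | no  1+a≢1+a = contradiction refl 1+a≢1+a

tridiag-super : ∀ p a → tridiag p a (suc a) ≡ 1
tridiag-super p a with a ≟ suc a
... | yes a≡1+a = contradiction (sym a≡1+a) 1+n≢n
... | no  _ with suc a ≟ suc a
...   | yes _       = refl
...   | no  1+a≢1+a = contradiction refl 1+a≢1+a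

tridiag-diag : ∀ p a → p ∸ 2 ≤ tridiag p a a
tridiag-diag p a with a ≟ a
... | no  a≢a = contradiction refl a≢a
... | yes _ with a ≟ 0
...   | yes _ = ∸-monoʳ-≤ p (s≤s z≤n)
...   | no  _ with a ≟ p ∸ 1
...     | yes _ = ∸-monoʳ-≤ p (s≤s z≤n)
...     | no  _ = ≤-refl

tridiag-last : ∀ n → tridiag (2 + n) (1 + n) (1 + n) ≡ 1 + n
tridiag-last n with suc n ≟ suc n
... | no  1+n≢1+n = contradiction refl 1+n≢1+n
... | yes _ with suc n ≟ suc n
...   | yes _       = refl
...   | no  1+n≢1+n = contradiction refl 1+n≢1+n

rowSum : ℕ → (ℕ → ℕ) → ℕ → ℕ
rowSum p g c = sumFrom 0 p (λ k → tridiag p c k * g k)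

Mx≡rowSum : ∀ p (x : Fin p → ℕ) {c} (c<p : c < p) → Mx p x (fromℕ< c<p) ≡ rowSum p (extend x) c
Mx≡rowSum p x c<p = Σ[Fin]≡sumFrom p λ j →
  cong₂ _*_ (cong (λ a → tridiag p a (toℕ j)) (sym (toℕ-fromℕ< c<p))) (extend-toℕ x j)

-- Solutions of M g ≤ N

-- The size is written 2 + n so that p ∸ 1 and p ∸ 2 compute to 1 + n and n.
module TridiagonalSystem (n N : ℕ) (g : ℕ → ℕ)
                         (row≤ : ∀ c → c < 2 + n → rowSum (2 + n) g c ≤ N) where

  p : ℕ
  p = 2 + n

  private
    row-window≤ : ∀ {c} a w → c < p → a + w ≤ p → sumFrom a w (λ k → tridiag p c k * g k) ≤ N
    row-window≤ {c} a w c<p a+w≤p =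
      ≤-trans (window≤sumFrom {a} {w} (λ k → tridiag p c k * g k) a+w≤p) (row≤ c c<p)

  row-first : (1 + n) * g 0 + g 1 ≤ N
  row-first = subst (_≤ N) (cong ((1 + n) * g 0 +_) (tidy (g 1))) (row-window≤ 0 2 z<s (s≤s (s≤s z≤n)))
    where
    tidy : ∀ x → 1 * x + 0 ≡ x
    tidy = solve-∀

  row-last : g n + (1 + n) * g (1 + n) ≤ N
  row-last = begin
    g n + (1 + n) * g (1 + n)
      ≡⟨ tidy (g n) ((1 + n) * g (1 + n)) ⟨
    1 * g n + ((1 + n) * g (1 + n) + 0)
      ≡⟨ cong₂ (λ a b → a * g n + (b * g (1 + n) + 0)) (tridiag-sub p n) (tridiag-last n) ⟨
    sumFrom n 2 (λ k → tridiag p (1 + n) k * g k)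
      ≤⟨ row-window≤ n 2 ≤-refl (≤-reflexive (+-comm n 2)) ⟩
    N ∎
    where
    open ≤-Reasoning
    tidy : ∀ x y → 1 * x + (y + 0) ≡ x + y
    tidy = solve-∀

  row-interior : ∀ j → j + 3 ≤ p → g j + n * g (1 + j) + g (2 + j) ≤ N
  row-interior j j+3≤p = begin
    g j + n * g (1 + j) + g (2 + j)
      ≡⟨ tidy (g j) (n * g (1 + j)) (g (2 + j)) ⟨
    1 * g j + (n * g (1 + j) + (1 * g (2 + j) + 0))
      ≡⟨ cong₂ (λ a c → a * g j + (n * g (1 + j) + (c * g (2 + j) + 0))) (tridiag-sub p j) (tridiag-super p (1 + j)) ⟨
    tridiag p (1 + j) j * g j + (n * g (1 + j) + (tridiag p (1 + j) (2 + j) * g (2 + j) + 0))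
      ≤⟨ +-monoʳ-≤ (tridiag p (1 + j) j * g j) (+-monoˡ-≤ (tridiag p (1 + j) (2 + j) * g (2 + j) + 0) n≤diag) ⟩
    sumFrom j 3 (λ k → tridiag p (1 + j) k * g k)
      ≤⟨ row-window≤ j 3 1+j<p j+3≤p ⟩
    N ∎
    where
    open ≤-Reasoning
    1+j<p : 1 + j < p
    1+j<p = ≤-trans (n≤1+n (2 + j)) (subst (_≤ p) (+-comm j 3) j+3≤p)
    n≤diag : n * g (1 + j) ≤ tridiag p (1 + j) (1 + j) * g (1 + j)
    n≤diag = *-monoˡ-≤ (g (1 + j)) (tridiag-diag p (1 + j))
    tidy : ∀ x y z → 1 * x + (y + (1 * z + 0)) ≡ x + y + z
    tidy = solve-∀

  small : ℕ → ℕ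
  small k = indicator (p * g k ≤? N)

  smallCount : ℕ → ℕ
  smallCount k = sumFrom 0 k small

  small-first : 1 ≤ sumFrom 0 2 small
  small-first = indicator-some₂ (p * g 0 ≤? N) (p * g 1 ≤? N) λ ¬small₀ ¬small₁ →
    <⇒≱ (<-weightedSum (1 + n) 1 0 (g 0) (g 1) (g 1) (weights n)
                       (≰⇒> ¬small₀) (≰⇒> ¬small₁) (≰⇒> ¬small₁))
        (subst (_≤ N) (sym (tidy ((1 + n) * g 0) (g 1))) row-first)
    where
    weights : ∀ n → 2 + n ≡ 1 + n + 1 + 0
    weights = solve-∀
    tidy : ∀ x y → x + 1 * y + 0 * y ≡ x + y
    tidy = solve-∀

  small-last : 1 ≤ sumFrom n 2 small
  small-last = indicator-some₂ (p * g n ≤? N) (p * g (1 + n) ≤? N) λ ¬smallₙ ¬small₁₊ₙ →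
    <⇒≱ (<-weightedSum 1 (1 + n) 0 (g n) (g (1 + n)) (g n) (weights n)
                       (≰⇒> ¬smallₙ) (≰⇒> ¬small₁₊ₙ) (≰⇒> ¬smallₙ))
        (subst (_≤ N) (sym (tidy (g n) ((1 + n) * g (1 + n)))) row-last)
    where
    weights : ∀ n → 2 + n ≡ 1 + (1 + n) + 0
    weights = solve-∀
    tidy : ∀ x y → 1 * x + y + 0 * x ≡ x + y
    tidy = solve-∀

  small-interior : ∀ j → j + 3 ≤ p → 1 ≤ sumFrom j 3 small
  small-interior j j+3≤p =
    indicator-some₃ (p * g j ≤? N) (p * g (1 + j) ≤? N) (p * g (2 + j) ≤? N) λ ¬small₀ ¬small₁ ¬small₂ →
    <⇒≱ (<-weightedSum 1 n 1 (g j) (g (1 + j)) (g (2 + j)) (weights n)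
                       (≰⇒> ¬small₀) (≰⇒> ¬small₁) (≰⇒> ¬small₂))
        (subst (_≤ N) (sym (tidy (g j) (n * g (1 + j)) (g (2 + j)))) (row-interior j j+3≤p))
    where
    weights : ∀ n → 2 + n ≡ 1 + n + 1
    weights = solve-∀
    tidy : ∀ x y z → 1 * x + y + 1 * z ≡ x + y + z
    tidy = solve-∀

  private
    prefix-bound-≤4 : ∀ {k} → 2 ≤ k → k ≤ 4 → k ≤ 1 + 3 * smallCount k
    prefix-bound-≤4 2≤k k≤4 =
      ≤-trans k≤4 (+-monoʳ-≤ 1 (*-monoʳ-≤ 3 (≤-trans small-first (window≤sumFrom {0} {2} small 2≤k))))

  -- Each of the blocks {0, 1}, {2, 3, 4}, {5, 6, 7}, … contains a small index.
  prefix-bound : ∀ k → 2 ≤ k → k ≤ p → k ≤ 1 + 3 * smallCount k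
  prefix-bound 1 (s≤s ()) _
  prefix-bound 2 2≤k _ = prefix-bound-≤4 2≤k (s≤s (s≤s z≤n))
  prefix-bound 3 2≤k _ = prefix-bound-≤4 2≤k (s≤s (s≤s (s≤s z≤n)))
  prefix-bound 4 2≤k _ = prefix-bound-≤4 2≤k ≤-refl
  prefix-bound (suc (suc (suc k@(suc (suc _))))) _ 3+k≤p = begin
    3 + k
      ≤⟨ +-monoʳ-≤ 3 (prefix-bound k (s≤s (s≤s z≤n)) (≤-trans (m≤n+m k 3) 3+k≤p)) ⟩
    3 + (1 + 3 * smallCount k)
      ≡⟨ rearrange (smallCount k) ⟩
    1 + 3 * (smallCount k + 1)
      ≤⟨ +-monoʳ-≤ 1 (*-monoʳ-≤ 3 (+-monoʳ-≤ (smallCount k) (small-interior k k+3≤p))) ⟩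
    1 + 3 * (smallCount k + sumFrom k 3 small)
      ≡⟨ cong (λ t → 1 + 3 * t) (sumFrom-+ 0 k 3 small) ⟨
    1 + 3 * smallCount (k + 3)
      ≡⟨ cong (λ t → 1 + 3 * smallCount t) (+-comm k 3) ⟩
    1 + 3 * smallCount (3 + k) ∎
    where
    open ≤-Reasoning
    k+3≤p : k + 3 ≤ p
    k+3≤p = subst (_≤ p) (+-comm 3 k) 3+k≤p
    rearrange : ∀ s → 3 + (1 + 3 * s) ≡ 1 + 3 * (s + 1)
    rearrange = solve-∀

  smallCount-bound : 2 ≤ n → (p + 2) / 3 ≤ smallCount p
  smallCount-bound 2≤n = [m+2]/3≤n (begin
    p                                          ≡⟨ +-comm 2 n ⟩
    n + 2                                      ≤⟨ +-monoˡ-≤ 2 (prefix-bound n 2≤n (m≤n+m n 2)) ⟩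
    1 + 3 * smallCount n + 2                   ≡⟨ rearrange (smallCount n) ⟩
    3 * (smallCount n + 1)                     ≤⟨ *-monoʳ-≤ 3 (+-monoʳ-≤ (smallCount n) small-last) ⟩
    3 * (smallCount n + sumFrom n 2 small)     ≡⟨ cong (3 *_) (sumFrom-+ 0 n 2 small) ⟨
    3 * smallCount (n + 2)                     ≡⟨ cong (λ t → 3 * smallCount t) (+-comm n 2) ⟩
    3 * smallCount p                           ∎)
    where
    open ≤-Reasoning
    rearrange : ∀ s → 1 + 3 * s + 2 ≡ 3 * (s + 1)
    rearrange = solve-∀

  isMax : ℕ → ℕ → ℕ
  isMax m k = indicator (g k ≟ m)

  module _ {m : ℕ} (g≤m : ∀ k → g k ≤ m) where

    lifted : ℕ → ℕ
    lifted k = g k + 1 ∸ isMax m k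

    private
      lifted≤m : ∀ k → lifted k ≤ m
      lifted≤m k = +1∸indicator≤ (g≤m k) (g k ≟ m)

      lifted≤ : ∀ k → lifted k ≤ g k + 1
      lifted≤ k = m∸n≤m (g k + 1) (isMax m k)

      lifted+isMax : ∀ k → lifted k + isMax m k ≡ g k + 1
      lifted+isMax k = m∸n+n≡m (≤-trans (indicator≤1 (g k ≟ m)) (m≤n+m 1 (g k)))

    lifted-sum : ∀ c₀ → c₀ < p → g c₀ ≡ m → sumFrom 0 p lifted ≤ N + 2
    lifted-sum zero _ g₀≡m = begin
      sumFrom 0 p lifted
        ≤⟨ sumFrom≤window 0 2 n refl lifted≤m ⟩
      lifted 0 + (lifted 1 + 0) + n * m
        ≤⟨ +-monoˡ-≤ (n * m) (+-mono-≤ (lifted≤m 0) (+-monoˡ-≤ 0 (lifted≤ 1))) ⟩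
      m + (g 1 + 1 + 0) + n * m
        ≡⟨ rearrange n m (g 1) ⟩
      (1 + n) * m + g 1 + 1
        ≤⟨ +-monoˡ-≤ 1 (subst (λ t → (1 + n) * t + g 1 ≤ N) g₀≡m row-first) ⟩
      N + 1
        ≤⟨ +-monoʳ-≤ N (n≤1+n 1) ⟩
      N + 2 ∎
      where
      open ≤-Reasoning
      rearrange : ∀ n m y → m + (y + 1 + 0) + n * m ≡ (1 + n) * m + y + 1
      rearrange = solve-∀
    lifted-sum (suc j) 1+j<p g₁₊ⱼ≡m with m<1+n⇒m<n∨m≡n (s≤s⁻¹ 1+j<p)
    ... | inj₂ refl = begin
      sumFrom 0 p lifted
        ≤⟨ sumFrom≤window j 2 0 (window j) lifted≤m ⟩
      lifted j + (lifted (1 + j) + 0) + (j + 0) * m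
        ≤⟨ +-monoˡ-≤ ((j + 0) * m) (+-mono-≤ (lifted≤ j) (+-monoˡ-≤ 0 (lifted≤m (1 + j)))) ⟩
      g j + 1 + (m + 0) + (j + 0) * m
        ≡⟨ rearrange j m (g j) ⟩
      g j + (1 + j) * m + 1
        ≤⟨ +-monoˡ-≤ 1 (subst (λ t → g j + (1 + j) * t ≤ N) g₁₊ⱼ≡m row-last) ⟩
      N + 1
        ≤⟨ +-monoʳ-≤ N (n≤1+n 1) ⟩
      N + 2 ∎
      where
      open ≤-Reasoning
      window : ∀ j → j + 2 + 0 ≡ 2 + j
      window = solve-∀
      rearrange : ∀ j m x → x + 1 + (m + 0) + (j + 0) * m ≡ x + (1 + j) * m + 1
      rearrange = solve-∀
    ... | inj₁ j<n with m≤n⇒∃[o]m+o≡n j<n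
    ...   | b , 1+j+b≡n = begin
      sumFrom 0 p lifted
        ≤⟨ sumFrom≤window j 3 b window lifted≤m ⟩
      lifted j + (lifted (1 + j) + (lifted (2 + j) + 0)) + (j + b) * m
        ≤⟨ +-monoˡ-≤ ((j + b) * m) (+-mono-≤ (lifted≤ j) (+-mono-≤ (lifted≤m (1 + j)) (+-monoˡ-≤ 0 (lifted≤ (2 + j))))) ⟩
      g j + 1 + (m + (g (2 + j) + 1 + 0)) + (j + b) * m
        ≡⟨ rearrange j b m (g j) (g (2 + j)) ⟩
      g j + (1 + j + b) * m + g (2 + j) + 2
        ≤⟨ +-monoˡ-≤ 2 row ⟩
      N + 2 ∎
      where
      open ≤-Reasoning
      shift : ∀ j b → j + 3 + b ≡ 2 + (1 + j + b)
      shift = solve-∀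
      window : j + 3 + b ≡ p
      window = trans (shift j b) (cong (2 +_) 1+j+b≡n)
      row : g j + (1 + j + b) * m + g (2 + j) ≤ N
      row = subst₂ (λ s t → g j + s * t + g (2 + j) ≤ N) (sym 1+j+b≡n) g₁₊ⱼ≡m
                   (row-interior j (≤-trans (m≤m+n (j + 3) b) (≤-reflexive window)))
      rearrange : ∀ j b m x y → x + 1 + (m + (y + 1 + 0)) + (j + b) * m ≡ x + (1 + j + b) * m + y + 2
      rearrange = solve-∀

    maxCount-bound : ∀ c₀ → c₀ < p → g c₀ ≡ m → p + sumFrom 0 p g ≤ N + 2 + sumFrom 0 p (isMax m)
    maxCount-bound c₀ c₀<p g₀≡m = begin
      p + sumFrom 0 p g
        ≡⟨ cong (_+ sumFrom 0 p g) (trans (sym (*-identityʳ p)) (sym (sumFrom-const 0 p 1))) ⟩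
      sumFrom 0 p (λ _ → 1) + sumFrom 0 p g
        ≡⟨ +-comm _ (sumFrom 0 p g) ⟩
      sumFrom 0 p g + sumFrom 0 p (λ _ → 1)
        ≡⟨ sumFrom-distrib-+ 0 p g (λ _ → 1) ⟨
      sumFrom 0 p (λ k → g k + 1)
        ≤⟨ sumFrom-mono 0 p (λ k → ≤-reflexive (sym (lifted+isMax k))) ⟩
      sumFrom 0 p (λ k → lifted k + isMax m k)
        ≡⟨ sumFrom-distrib-+ 0 p lifted (isMax m) ⟩
      sumFrom 0 p lifted + sumFrom 0 p (isMax m)
        ≤⟨ +-monoˡ-≤ _ (lifted-sum c₀ c₀<p g₀≡m) ⟩
      N + 2 + sumFrom 0 p (isMax m) ∎
      where open ≤-Reasoning

    sum-bound : ∀ c₀ → c₀ < p → g c₀ ≡ m → N % p ≡ 1 + n → 2 ≤ n →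
                sumFrom 0 p g + (p + 2) / 3 ≤ N + 2
    sum-bound c₀ c₀<p g₀≡m N%p≡p-1 2≤n with p * m ≤? N
    ... | yes pm≤N = begin
      sumFrom 0 p g + (p + 2) / 3         ≤⟨ +-mono-≤ (sumFrom≤* 0 p g≤m) ⌈p/3⌉≤p+1 ⟩
      p * m + (3 + n)                     ≤⟨ +-monoˡ-≤ (3 + n) (*-monoʳ-≤ p m≤N/p) ⟩
      p * (N / p) + (3 + n)               ≡⟨ rearrange n (N / p) ⟩
      (1 + n) + N / p * p + 2             ≡⟨ cong (λ r → r + N / p * p + 2) N%p≡p-1 ⟨
      N % p + N / p * p + 2               ≡⟨ cong (_+ 2) (m≡m%n+[m/n]*n N p) ⟨
      N + 2                               ∎
      where
      open ≤-Reasoning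
      rearrange : ∀ n q → (2 + n) * q + (3 + n) ≡ 1 + n + q * (2 + n) + 2
      rearrange = solve-∀
      ⌈p/3⌉≤p+1 : (p + 2) / 3 ≤ 3 + n
      ⌈p/3⌉≤p+1 =
        s≤s⁻¹ (≤-trans (m/n<m (p + 2) 3 (s≤s (s≤s z≤n))) (≤-reflexive (cong (2 +_) (+-comm n 2))))
      m≤N/p : m ≤ N / p
      m≤N/p = s≤s⁻¹ (*-cancelʳ-< p m (suc (N / p)) (begin-strict
        m * p                 ≡⟨ *-comm m p ⟩
        p * m                 ≤⟨ pm≤N ⟩
        N                     ≡⟨ m≡m%n+[m/n]*n N p ⟩
        N % p + N / p * p     ≡⟨ cong (_+ N / p * p) N%p≡p-1 ⟩
        1 + n + N / p * p     <⟨ +-monoˡ-< (N / p * p) ≤-refl ⟩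
        suc (N / p) * p       ∎))
    ... | no pm≰N = +-cancelˡ-≤ p _ _ (begin
      p + (sumFrom 0 p g + (p + 2) / 3)
        ≡⟨ +-assoc p _ _ ⟨
      p + sumFrom 0 p g + (p + 2) / 3
        ≤⟨ +-mono-≤ (maxCount-bound c₀ c₀<p g₀≡m) (smallCount-bound 2≤n) ⟩
      N + 2 + sumFrom 0 p (isMax m) + smallCount p
        ≡⟨ +-assoc (N + 2) _ _ ⟩
      N + 2 + (sumFrom 0 p (isMax m) + smallCount p)
        ≡⟨ cong (N + 2 +_) (sumFrom-distrib-+ 0 p (isMax m) small) ⟨
      N + 2 + sumFrom 0 p (λ k → isMax m k + small k)
        ≤⟨ +-monoʳ-≤ (N + 2) (sumFrom≤* 0 p maxNotSmall) ⟩
      N + 2 + p * 1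
        ≡⟨ trans (cong (N + 2 +_) (*-identityʳ p)) (+-comm (N + 2) p) ⟩
      p + (N + 2) ∎)
      where
      open ≤-Reasoning
      maxNotSmall : ∀ k → isMax m k + small k ≤ 1
      maxNotSmall k = indicator-disjoint (g k ≟ m) (p * g k ≤? N) λ gk≡m pgk≤N →
        pm≰N (subst (λ t → p * t ≤ N) gk≡m pgk≤N)

-- Imported only here: the prefix `+_` of ℤ would make the sections `(x +_)` above ambiguous.
open import Data.Integer using (ℤ; +_; +≤+) renaming (_+_ to _+ℤ_; _-_ to _-ℤ_; _≤_ to _≤ℤ_; -_ to -ℤ_)
import Data.Integer.Properties as ℤ
import Data.Integer.Tactic.RingSolver as ℤ-Solver

ℤ-shortfall : ∀ {p S N c : ℕ} (k : ℤ) → + S ≡ + N -ℤ k → p + S ≤ N + 2 + c →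
              (+ p -ℤ k) -ℤ + 2 ≤ℤ + c
ℤ-shortfall {p} {S} {N} {c} k S≡N-k p+S≤ =
  ℤ.≤-trans (ℤ.≤-reflexive shortfall≡)
    (ℤ.≤-trans (ℤ.+-monoˡ-≤ (-ℤ (+ N +ℤ + 2)) (+≤+ p+S≤)) (ℤ.≤-reflexive (cancel (+ N +ℤ + 2) (+ c))))
  where
  k≡ : k ≡ + N -ℤ + S
  k≡ = trans (rearrangeK k (+ N)) (cong (λ t → + N -ℤ t) (sym S≡N-k))
    where
    rearrangeK : ∀ k N → k ≡ N -ℤ (N -ℤ k)
    rearrangeK = ℤ-Solver.solve-∀
  shortfall≡ : (+ p -ℤ k) -ℤ + 2 ≡ (+ p +ℤ + S) +ℤ -ℤ (+ N +ℤ + 2)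
  shortfall≡ = trans (cong (λ t → (+ p -ℤ t) -ℤ + 2) k≡) (rearrange (+ p) (+ N) (+ S))
    where
    rearrange : ∀ p N S → (p -ℤ (N -ℤ S)) -ℤ + 2 ≡ (p +ℤ S) +ℤ -ℤ (N +ℤ + 2)
    rearrange = ℤ-Solver.solve-∀
  cancel : ∀ y z → (y +ℤ z) +ℤ -ℤ y ≡ z
  cancel = ℤ-Solver.solve-∀

mainTheorem8 : (p : ℕ) → Prime p → 7 ≤ p →
    (x : Fin p → ℕ) →
    (∀ i → Mx p x i ≤ (p ∸ 1) !) →
      (((p + 2) / 3 ≤ count p (λ i → p * x i ≤? (p ∸ 1) !))
      × (∀ (k : ℤ) → + Σ[Fin] p x ≡ + ((p ∸ 1) !) -ℤ k →
           (+ p -ℤ k) -ℤ + 2 ≤ℤ + count p (λ i → x i ≟ xmax p x))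
      × (Σ[Fin] p x + (p + 2) / 3 ≤ (p ∸ 1) ! + 2))
mainTheorem8 (suc (suc n)) p-prime (s≤s (s≤s 5≤n)) x Mx≤ =
    subst ((p + 2) / 3 ≤_) (sym (count≡sumFrom p (λ v → p * v ≤? N) x)) (smallCount-bound 2≤n)
  , (λ k Σx≡N-k → ℤ-shortfall k Σx≡N-k
      (subst₂ (λ S c → p + S ≤ N + 2 + c) (sym Σx≡) (sym (count≡sumFrom p (λ v → v ≟ m) x))
        (maxCount-bound g≤m c₀ c₀<p g₀≡m)))
  , subst (λ S → S + (p + 2) / 3 ≤ N + 2) (sym Σx≡)
          (sum-bound g≤m c₀ c₀<p g₀≡m (wilson p-prime) 2≤n)
  where
  N : ℕ
  N = (1 + n) !
  open TridiagonalSystem n N (extend x)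
         (λ c c<p → subst (_≤ N) (Mx≡rowSum (2 + n) x c<p) (Mx≤ (fromℕ< c<p)))
  2≤n : 2 ≤ n
  2≤n = ≤-trans (s≤s (s≤s z≤n)) 5≤n
  m : ℕ
  m = xmax p x
  g≤m : ∀ k → extend x k ≤ m
  g≤m = extend-≤ x (xmax-upper p x)
  i₀ : Fin p
  i₀ = proj₁ (xmax-attained (1 + n) x)
  c₀ : ℕ
  c₀ = toℕ i₀
  c₀<p : c₀ < p
  c₀<p = toℕ<n i₀
  g₀≡m : extend x c₀ ≡ m
  g₀≡m = trans (extend-toℕ x i₀) (proj₂ (xmax-attained (1 + n) x))
  Σx≡ : Σ[Fin] p x ≡ sumFrom 0 p (extend x)
  Σx≡ = Σ[Fin]≡sumFrom p {g = extend x} (extend-toℕ x)
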